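{- Let $\mathbf P=(P,\leq,{}',0,1)$ be an orthogonal lub-complete poset. Then the following are equivalent: (i) $\mathbf P$ is an orthocomplemented poset; (ii) for all $x,y\in P$, $x\leq y$ implies $x\rightarrow_C y=\{1\}$.
   Context: For a poset $(P,\leq)$ and $A\subseteq P$: $L(A)=\{x: x\leq a\ \forall a\in A\}$, $U(A)=\{x: a\leq x\ \forall a\in A\}$, $U(x,y)=U(\{x,y\})$; $\operatorname{Min}A$ is the set of minimal elements of $A$. A bounded poset $(P,\leq,{}',0,1)$ with antitone involution: $x\leq y\Rightarrow y'\leq x'$, $x''=x$. $x\perp y$ iff $x\leq y'$. Orthogonal: $x\perp y$ implies the supremum $x\vee y$ exists. Lub-complete: for every finite $M\subseteq P$ and lower bound $x$ of $M$ there is a maximal element of $L(M)$ above $x$. Orthocomplemented: $x\vee x'=1$ for every $x\in P$. Classical implication: $x\rightarrow_C y=\operatorname{Min}U(x',y)$. -}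

module Defs where

open import Level using (Level; _⊔_; suc)
open import Data.Product using (Σ; _×_; ∃)
open import Data.List using (List)
open import Data.List.Membership.Propositional using (_∈_)
open import Relation.Binary.PropositionalEquality using (_≡_)
open import Function.Bundles using (_⇔_)

record BoundedInvPoset (c ℓ : Level) : Set (suc (c ⊔ ℓ)) where
  infix 4 _≤_
  field
    Carrier   : Set c
    _≤_       : Carrier → Carrier → Set ℓ
    ≤-refl    : ∀ {x} → x ≤ x
    ≤-antisym : ∀ {x y} → x ≤ y → y ≤ x → x ≡ y
    ≤-trans   : ∀ {x y z} → x ≤ y → y ≤ z → x ≤ z
    _′        : Carrier → Carrier
    𝟘         : Carrier
    𝟙         : Carrier
    𝟘-least   : ∀ x → 𝟘 ≤ x
    𝟙-greatest : ∀ x → x ≤ 𝟙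
    antitone  : ∀ {x y} → x ≤ y → y ′ ≤ x ′
    involutive : ∀ x → (x ′) ′ ≡ x

module _ {c ℓ : Level} (P : BoundedInvPoset c ℓ) where
  open BoundedInvPoset P

  Subset : Set (suc c ⊔ suc ℓ)
  Subset = Carrier → Set (c ⊔ ℓ)

  L : List Carrier → Carrier → Set (c ⊔ ℓ)
  L A z = ∀ a → a ∈ A → z ≤ a

  U : List Carrier → Carrier → Set (c ⊔ ℓ)
  U A z = ∀ a → a ∈ A → a ≤ z

  U₂ : Carrier → Carrier → Carrier → Set ℓ
  U₂ x y z = (x ≤ z) × (y ≤ z)

  Min : (Carrier → Set (c ⊔ ℓ)) → Carrier → Set (c ⊔ ℓ)
  Min A z = A z × (∀ w → A w → w ≤ z → w ≡ z)

  _⊥_ : Carrier → Carrier → Set ℓ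
  x ⊥ y = x ≤ y ′

  IsSup : Carrier → Carrier → Carrier → Set (c ⊔ ℓ)
  IsSup x y s = (x ≤ s) × (y ≤ s) × (∀ z → x ≤ z → y ≤ z → s ≤ z)

  Orthogonal : Set (c ⊔ ℓ)
  Orthogonal = ∀ x y → x ⊥ y → Σ Carrier (IsSup x y)

  LubComplete : Set (c ⊔ ℓ)
  LubComplete = ∀ (M : List Carrier) x → L M x →
    Σ Carrier λ m → L M m × (x ≤ m) × (∀ z → L M z → m ≤ z → z ≡ m)

  Orthocomplemented : Set (c ⊔ ℓ)
  Orthocomplemented = ∀ x → IsSup x (x ′) 𝟙

  _→C_ : Carrier → Carrier → Carrier → Set (c ⊔ ℓ)
  (x →C y) z = Min (λ w → Lift-U (x ′) y w) z
    where
      Lift-U : Carrier → Carrier → Carrier → Set (c ⊔ ℓ)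
      Lift-U a b w = Level.Lift c (U₂ a b w)

  IsSingleton𝟙 : (Carrier → Set (c ⊔ ℓ)) → Set (c ⊔ ℓ)
  IsSingleton𝟙 S = ∀ z → S z ⇔ (z ≡ 𝟙)

-- If x ∨ x′ = 1, every upper bound of x′ and of some y ≥ x lies above both x and x′, hence is 1,
-- so x →C y = {1}. Conversely, the antitone involution turns U(x′, y) into L(x, y′), minimal
-- elements into maximal ones. Given an upper bound z of x and x′, lub-completeness yields a
-- maximal m ∈ L(x, x′) above z′; then m′ ∈ x →C x = {1}, whence 1 = m′ ≤ z.
module Submission where

open import Defs
open import Level using (Level; lift; lower)
open import Function.Bundles using (_⇔_; mk⇔; Equivalence)
open import Data.Product using (_,_)
open import Data.List using (_∷_; [])
open import Data.List.Relation.Unary.Any using (here; there)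
open import Relation.Binary.PropositionalEquality using (_≡_; refl; sym; trans; cong; subst)

module _ {c ℓ : Level} (P : BoundedInvPoset c ℓ) where
  open BoundedInvPoset P

  ≤′⇒≤′ : ∀ {a b} → a ≤ b ′ → b ≤ a ′
  ≤′⇒≤′ {a} {b} p = subst (_≤ a ′) (involutive b) (antitone p)

  ′≤⇒′≤ : ∀ {a b} → a ′ ≤ b → b ′ ≤ a
  ′≤⇒′≤ {a} {b} p = subst (b ′ ≤_) (involutive a) (antitone p)

  upper-of-join-𝟙 : ∀ {a b z} → IsSup P a b 𝟙 → a ≤ z → b ≤ z → z ≡ 𝟙
  upper-of-join-𝟙 {z = z} (_ , _ , least) a≤z b≤z = ≤-antisym (𝟙-greatest z) (least z a≤z b≤z)

  →C-≡-𝟙 : ∀ {x y} → IsSup P x (x ′) 𝟙 → x ≤ y → IsSingleton𝟙 P (_→C_ P x y)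
  →C-≡-𝟙 {x} {y} join x≤y z = mk⇔ in→≡𝟙 ≡𝟙→in
    where
    upper≡𝟙 : ∀ {w} → U₂ P (x ′) y w → w ≡ 𝟙
    upper≡𝟙 (x′≤w , y≤w) = upper-of-join-𝟙 join (≤-trans x≤y y≤w) x′≤w

    in→≡𝟙 : _→C_ P x y z → z ≡ 𝟙
    in→≡𝟙 (lift u , _) = upper≡𝟙 u

    ≡𝟙→in : z ≡ 𝟙 → _→C_ P x y z
    ≡𝟙→in refl = lift (𝟙-greatest _ , 𝟙-greatest _) , λ w (lift u) _ → upper≡𝟙 u

  upper⇒′-lower : ∀ {a b w} → U₂ P (a ′) b w → L P (a ∷ b ′ ∷ []) (w ′)
  upper⇒′-lower (a′≤w , _) _ (here refl) = ′≤⇒′≤ a′≤w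
  upper⇒′-lower (_ , b≤w) _ (there (here refl)) = antitone b≤w

  lower⇒′-upper : ∀ {a b v} → L P (a ∷ b ′ ∷ []) v → U₂ P (a ′) b (v ′)
  lower⇒′-upper v-lower = antitone (v-lower _ (here refl)) , ≤′⇒≤′ (v-lower _ (there (here refl)))

  maximal-lower⇒→C : ∀ {a b m} → L P (a ∷ b ′ ∷ []) m →
    (∀ v → L P (a ∷ b ′ ∷ []) v → m ≤ v → v ≡ m) → _→C_ P a b (m ′)
  maximal-lower⇒→C {m = m} m-lower maximal = lift (lower⇒′-upper m-lower) , minimal
    where
    minimal : ∀ w → Level.Lift c (U₂ P _ _ w) → w ≤ m ′ → w ≡ m ′
    minimal w (lift w-upper) w≤m′ =
      trans (sym (involutive w)) (cong _′ (maximal (w ′) (upper⇒′-lower w-upper) (≤′⇒≤′ w≤m′)))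

  join-𝟙-from-→C : LubComplete P → ∀ x → IsSingleton𝟙 P (_→C_ P x x) → IsSup P x (x ′) 𝟙
  join-𝟙-from-→C lub-complete x →C≡𝟙 = 𝟙-greatest x , 𝟙-greatest (x ′) , 𝟙-least
    where
    𝟙-least : ∀ z → x ≤ z → x ′ ≤ z → 𝟙 ≤ z
    𝟙-least z x≤z x′≤z with lub-complete _ (z ′) (upper⇒′-lower (x′≤z , x≤z))
    ... | m , m-lower , z′≤m , maximal = subst (_≤ z) m′≡𝟙 (′≤⇒′≤ z′≤m)
      where
      m′≡𝟙 : m ′ ≡ 𝟙
      m′≡𝟙 = Equivalence.to (→C≡𝟙 (m ′)) (maximal-lower⇒→C m-lower maximal)

theorem1 : ∀ {c ℓ : Level} (P : BoundedInvPoset c ℓ) →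
    Orthogonal P → LubComplete P →
    (Orthocomplemented P ⇔
      (∀ x y → BoundedInvPoset._≤_ P x y → IsSingleton𝟙 P (_→C_ P x y)))
theorem1 P _ lub-complete = mk⇔
  (λ orthocomplemented x y x≤y → →C-≡-𝟙 P (orthocomplemented x) x≤y)
  (λ →C≡𝟙 x → join-𝟙-from-→C P lub-complete x (→C≡𝟙 x x (BoundedInvPoset.≤-refl P)))
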